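{- Let $E$ be a finite set and $\mathbb{G}$ an $\mathsf{E}$-group. If $\mathbb{G}$ is compatible with $\mathrm{Cayley}(\mathbb{G})[\alpha]$ for every $\alpha\subsetneq E$, then $\mathbb{G}$ is $3$-acyclic.
   Context: An $\mathsf{E}$-group is a group $\mathbb{G}=(G,\cdot,1)$ containing $E$ as a set of pairwise distinct non-trivial involutions that generate it; for $w=e_1\cdots e_n\in E^*$, $[w]_{\mathbb{G}}=e_1\cdots e_n$; for $\alpha\subseteq E$, $\mathbb{G}[\alpha]=\{[w]_{\mathbb{G}}:w\in\alpha^*\}$. An $\mathsf{E}$-graph is $(V,(R_e)_{e\in E})$ with each $R_e$ symmetric and every vertex having at most one $R_e$-neighbour; $\pi_e\in\mathrm{Sym}(V)$ swaps the ends of each $R_e$-edge and fixes all other vertices, and $[w]_{\mathbb{H}}=\pi_{e_n}\circ\cdots\circ\pi_{e_1}$. $\mathrm{Cayley}(\mathbb{G})[\alpha]$ is the $\mathsf{E}$-graph with vertex set $\mathbb{G}[\alpha]$, $R_e=\{(g,ge):g\in\mathbb{G}[\alpha]\}$ for $e\in\alpha$ and $R_e=\emptyset$ for $e\notin\alpha$. $\mathbb{G}$ is compatible with an $\mathsf{E}$-graph $\mathbb{H}$ on vertex set $V$ if $[w]_{\mathbb{G}}=1$ implies $[w]_{\mathbb{H}}=\mathrm{id}_V$ for all $w\in E^*$. A coset cycle of length $n\geq2$ in $\mathbb{G}$ is $(g_i\mathbb{G}[\alpha_i],g_i)_{i\in\mathbb{Z}_n}$ with $g_i\in G$, $\alpha_i\subseteq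 E$, such that for all $i$: $g_{i+1}\in g_i\mathbb{G}[\alpha_i]$ and $g_i\mathbb{G}[\alpha_i\cap\alpha_{i-1}]\cap g_{i+1}\mathbb{G}[\alpha_i\cap\alpha_{i+1}]=\emptyset$. $\mathbb{G}$ is $N$-acyclic if it has no coset cycle of length $n$ with $2\le n\leq N$. -}

module Defs where

open import Level using (Level; _⊔_) renaming (suc to lsuc)
open import Data.Nat using (ℕ; suc; _≤_)
open import Data.Nat.DivMod using (_mod_)
open import Data.Fin using (Fin; toℕ)
open import Data.Fin.Subset using (Subset; _∈_; _∉_; _∩_; _⊂_; ⊤)
open import Data.Fin.Subset.Properties using (_∈?_)
open import Data.List using (List; []; _∷_)
open import Data.List.Relation.Unary.All using (All)
open import Data.Product using (Σ; ∃; _×_; _,_)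
open import Data.Bool using (if_then_else_)
open import Relation.Nullary using (¬_; does)
open import Relation.Binary.PropositionalEquality using (_≡_)
open import Algebra.Bundles using (Group)

next : {n : ℕ} → Fin n → Fin n
next {suc m} i = suc (toℕ i) mod suc m

prev : {n : ℕ} → Fin n → Fin n
prev {suc m} i = (toℕ i Data.Nat.+ m) mod suc m

module Words {c ℓ : Level} {k : ℕ} (𝔾 : Group c ℓ) (ι : Fin k → Group.Carrier 𝔾) where
  open Group 𝔾
  ⟦_⟧ : List (Fin k) → Carrier
  ⟦ [] ⟧ = ε
  ⟦ e ∷ w ⟧ = ι e ∙ ⟦ w ⟧

-- An E-group for the finite set E = Fin k: G contains E (via the injective ι)
-- as pairwise distinct non-trivial involutions generating G.
record EGroup {c ℓ : Level} (k : ℕ) (𝔾 : Group c ℓ) : Set (c ⊔ ℓ) where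
  open Group 𝔾
  field
    ι          : Fin k → Carrier
    distinct   : ∀ e f → ι e ≈ ι f → e ≡ f
    nontrivial : ∀ e → ¬ (ι e ≈ ε)
    involution : ∀ e → ι e ∙ ι e ≈ ε
    generates  : ∀ (g : Carrier) → ∃ λ (w : List (Fin k)) → Words.⟦_⟧ 𝔾 ι w ≈ g

  open Words 𝔾 ι public

  InSub : Subset k → Carrier → Set ℓ
  InSub α g = ∃ λ (w : List (Fin k)) → All (_∈ α) w × ⟦ w ⟧ ≈ g

  InCoset : Carrier → Subset k → Carrier → Set (c ⊔ ℓ)
  InCoset g α x = ∃ λ (h : Carrier) → InSub α h × x ≈ g ∙ h

  -- Cayley(G)[α]: π_e swaps g and g·e if e ∈ α (both then lie in G[α]),
  -- and fixes every vertex otherwise (R_e = ∅ for e ∉ α).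
  cayleyπ : Subset k → Fin k → Carrier → Carrier
  cayleyπ α e g = if does (e ∈? α) then g ∙ ι e else g

  -- [w]_H = π_{eₙ} ∘ ⋯ ∘ π_{e₁}  (π_{e₁} applied first)
  cayleyAct : Subset k → List (Fin k) → Carrier → Carrier
  cayleyAct α [] g = g
  cayleyAct α (e ∷ w) g = cayleyAct α w (cayleyπ α e g)

  CompatibleCayley : Subset k → Set (c ⊔ ℓ)
  CompatibleCayley α =
    ∀ (w : List (Fin k)) → ⟦ w ⟧ ≈ ε → ∀ (g : Carrier) → InSub α g → cayleyAct α w g ≈ g

  record CosetCycle (n : ℕ) : Set (c ⊔ ℓ) where
    field
      g     : Fin n → Carrier
      α     : Fin n → Subset k
      step  : ∀ i → InCoset (g i) (α i) (g (next i))
      disj  : ∀ i → ¬ (∃ λ (x : Carrier) →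
                 InCoset (g i) (α i ∩ α (prev i)) x ×
                 InCoset (g (next i)) (α i ∩ α (next i)) x)

  Acyclic : ℕ → Set (c ⊔ ℓ)
  Acyclic N = ∀ (n : ℕ) → 2 ≤ n → n ≤ N → ¬ CosetCycle n

-- Compatibility with Cayley(G)[α] says exactly that deleting all letters outside α from a
-- relator of G leaves a relator (for α = E this is vacuous).  Given a 3-cycle of cosets
-- g₁ = g₀u, g₂ = g₁v, g₀ = g₂w with u ∈ α₀*, v ∈ α₁*, w ∈ α₂*, the word uvw is a relator;
-- projecting it to α₀ gives u · v' · w' = 1 with v' ∈ (α₀ ∩ α₁)*, w' ∈ (α₀ ∩ α₂)*, so
-- g₁v' = g₀w'⁻¹ lies in both g₁G[α₀ ∩ α₁] and g₀G[α₀ ∩ α₂].  A 2-cycle is the case v = 1.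
module Submission where

open import Defs
open import Level using (Level)
open import Data.Nat using (ℕ; suc; s≤s)
open import Data.Fin using (Fin) renaming (zero to fz; suc to fs)
open import Data.Fin.Subset using (Subset; _⊂_; ⊤; _∈_; _∩_)
open import Data.Fin.Subset.Properties using (_∈?_; _⊂?_; ∈⊤; x∈p∩q⁺)
open import Data.List using (List; []; _∷_; _++_; filter; reverse)
open import Data.List.Properties using (filter-++; filter-all; unfold-reverse)
open import Data.List.Relation.Unary.All as All using (All; []; _∷_)
open import Data.List.Relation.Unary.All.Properties using (all-filter; filter⁺)
open import Data.List.Relation.Unary.Any.Properties using (reverse⁻)
open import Data.Product using (_,_; _×_; ∃)
open import Data.Bool using (true; false)
open import Relation.Nullary using (¬_; does; yes; no; contradiction)
open import Relation.Binary.PropositionalEquality as ≡ using (_≡_)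
open import Algebra.Bundles using (Group)
open import Function using (_∘_)

module _ {c ℓ : Level} {k : ℕ} {𝔾 : Group c ℓ} (E𝔾 : EGroup k 𝔾) where
  open Group 𝔾
  open EGroup E𝔾
  open import Algebra.Properties.Group 𝔾 using (ε⁻¹≈ε; ∙-cancelˡ; inverseˡ-unique; ⁻¹-anti-homo-∙)
  open import Relation.Binary.Reasoning.Setoid setoid

  ⟦⟧-++ : ∀ u v → ⟦ u ++ v ⟧ ≈ ⟦ u ⟧ ∙ ⟦ v ⟧
  ⟦⟧-++ []      v = sym (identityˡ _)
  ⟦⟧-++ (e ∷ u) v = trans (∙-congˡ (⟦⟧-++ u v)) (sym (assoc _ _ _))

  ⟦⟧-reverse : ∀ w → ⟦ reverse w ⟧ ≈ ⟦ w ⟧ ⁻¹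
  ⟦⟧-reverse []      = sym ε⁻¹≈ε
  ⟦⟧-reverse (e ∷ w) = begin
    ⟦ reverse (e ∷ w) ⟧          ≡⟨ ≡.cong ⟦_⟧ (unfold-reverse e w) ⟩
    ⟦ reverse w ++ e ∷ [] ⟧      ≈⟨ ⟦⟧-++ (reverse w) (e ∷ []) ⟩
    ⟦ reverse w ⟧ ∙ (ι e ∙ ε)    ≈⟨ ∙-cong (⟦⟧-reverse w) (identityʳ (ι e)) ⟩
    ⟦ w ⟧ ⁻¹ ∙ ι e               ≈⟨ ∙-congˡ (inverseˡ-unique (ι e) (ι e) (involution e)) ⟩
    ⟦ w ⟧ ⁻¹ ∙ ι e ⁻¹            ≈⟨ sym (⁻¹-anti-homo-∙ (ι e) ⟦ w ⟧) ⟩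
    (ι e ∙ ⟦ w ⟧) ⁻¹             ∎

  InSub-⁻¹ : ∀ {α g} → InSub α g → InSub α (g ⁻¹)
  InSub-⁻¹ (w , w∈α* , ⟦w⟧≈g) =
    reverse w , All.tabulate (All.lookup w∈α* ∘ reverse⁻) , trans (⟦⟧-reverse w) (⁻¹-cong ⟦w⟧≈g)

  restrict : Subset k → List (Fin k) → List (Fin k)
  restrict α = filter (_∈? α)

  restrict-∈ : ∀ {α β w} → All (_∈ β) w → All (_∈ α ∩ β) (restrict α w)
  restrict-∈ {α} {w = w} w∈β* =
    All.zipWith x∈p∩q⁺ (all-filter (_∈? α) w , filter⁺ (_∈? α) w∈β*)

  cayleyAct-restrict : ∀ α w g → cayleyAct α w g ≈ g ∙ ⟦ restrict α w ⟧
  cayleyAct-restrict α []      g = sym (identityʳ g)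
  cayleyAct-restrict α (e ∷ w) g with does (e ∈? α)
  ... | true  = trans (cayleyAct-restrict α w (g ∙ ι e)) (assoc _ _ _)
  ... | false = cayleyAct-restrict α w g

  CompatibleWithProperCayleys : Set _
  CompatibleWithProperCayleys = ∀ α → α ⊂ ⊤ → CompatibleCayley α

  restrict-full : ∀ {α} → ¬ α ⊂ ⊤ → ∀ w → restrict α w ≡ w
  restrict-full {α} α⊄⊤ w = filter-all (_∈? α) (All.universal full w)
    where
    full : ∀ e → e ∈ α
    full e with e ∈? α
    ... | yes e∈α = e∈α
    ... | no  e∉α = contradiction ((λ {_} _ → ∈⊤) , e , ∈⊤ , e∉α) α⊄⊤

  restrict-relator : CompatibleWithProperCayleys → ∀ α w → ⟦ w ⟧ ≈ ε → ⟦ restrict α w ⟧ ≈ ε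
  restrict-relator compatible α w ⟦w⟧≈ε with α ⊂? ⊤
  ... | yes α⊂⊤ = begin
    ⟦ restrict α w ⟧      ≈⟨ identityˡ _ ⟨
    ε ∙ ⟦ restrict α w ⟧  ≈⟨ cayleyAct-restrict α w ε ⟨
    cayleyAct α w ε       ≈⟨ compatible α α⊂⊤ w ⟦w⟧≈ε ε ([] , [] , refl) ⟩
    ε                     ∎
  ... | no α⊄⊤ = trans (reflexive (≡.cong ⟦_⟧ (restrict-full α⊄⊤ w))) ⟦w⟧≈ε

  InCoset⇒word : ∀ {g g′ α} → InCoset g α g′ → ∃ λ u → All (_∈ α) u × g′ ≈ g ∙ ⟦ u ⟧
  InCoset⇒word (h , (u , u∈α* , ⟦u⟧≈h) , g′≈gh) = u , u∈α* , trans g′≈gh (∙-congˡ (sym ⟦u⟧≈h))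

  triangle-relator : ∀ {g₀ g₁ g₂ a b c} →
    g₁ ≈ g₀ ∙ a → g₂ ≈ g₁ ∙ b → g₀ ≈ g₂ ∙ c → a ∙ (b ∙ c) ≈ ε
  triangle-relator {g₀} {g₁} {g₂} {a} {b} {c} g₁≈g₀a g₂≈g₁b g₀≈g₂c = ∙-cancelˡ g₀ _ _ (begin
    g₀ ∙ (a ∙ (b ∙ c))  ≈⟨ assoc g₀ a (b ∙ c) ⟨
    (g₀ ∙ a) ∙ (b ∙ c)  ≈⟨ ∙-congʳ g₁≈g₀a ⟨
    g₁ ∙ (b ∙ c)        ≈⟨ assoc g₁ b c ⟨
    (g₁ ∙ b) ∙ c        ≈⟨ ∙-congʳ g₂≈g₁b ⟨
    g₂ ∙ c              ≈⟨ g₀≈g₂c ⟨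
    g₀                  ≈⟨ identityʳ g₀ ⟨
    g₀ ∙ ε              ∎)

  relator-shift : ∀ {g₀ g₁ a b c} → g₁ ≈ g₀ ∙ a → a ∙ (b ∙ c) ≈ ε → g₁ ∙ b ≈ g₀ ∙ c ⁻¹
  relator-shift {g₀} {g₁} {a} {b} {c} g₁≈g₀a abc≈ε = begin
    g₁ ∙ b        ≈⟨ ∙-congʳ g₁≈g₀a ⟩
    (g₀ ∙ a) ∙ b  ≈⟨ assoc g₀ a b ⟩
    g₀ ∙ (a ∙ b)  ≈⟨ ∙-congˡ (inverseˡ-unique (a ∙ b) c (trans (assoc a b c) abc≈ε)) ⟩
    g₀ ∙ c ⁻¹     ∎

  restrict-triangle : CompatibleWithProperCayleys → ∀ {α} u v w → All (_∈ α) u →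
    ⟦ u ++ (v ++ w) ⟧ ≈ ε → ⟦ u ⟧ ∙ (⟦ restrict α v ⟧ ∙ ⟦ restrict α w ⟧) ≈ ε
  restrict-triangle compatible {α} u v w u∈α* uvw≈ε = begin
    ⟦ u ⟧ ∙ (⟦ restrict α v ⟧ ∙ ⟦ restrict α w ⟧)  ≈⟨ ∙-congˡ (⟦⟧-++ (restrict α v) _) ⟨
    ⟦ u ⟧ ∙ ⟦ restrict α v ++ restrict α w ⟧       ≈⟨ ⟦⟧-++ u _ ⟨
    ⟦ u ++ (restrict α v ++ restrict α w) ⟧        ≡⟨ ≡.cong ⟦_⟧ projection ⟨
    ⟦ restrict α (u ++ (v ++ w)) ⟧                 ≈⟨ restrict-relator compatible α (u ++ (v ++ w)) uvw≈ε ⟩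
    ε                                              ∎
    where
    projection : restrict α (u ++ (v ++ w)) ≡ u ++ (restrict α v ++ restrict α w)
    projection = ≡.trans (filter-++ (_∈? α) u (v ++ w))
      (≡.cong₂ _++_ (filter-all (_∈? α) u∈α*) (filter-++ (_∈? α) v w))

  coset-triangle-meet : CompatibleWithProperCayleys → ∀ {g₀ g₁ g₂ α β γ} →
    InCoset g₀ α g₁ → InCoset g₁ β g₂ → InCoset g₂ γ g₀ →
    ∃ λ x → InCoset g₀ (α ∩ γ) x × InCoset g₁ (α ∩ β) x
  coset-triangle-meet compatible {g₀} {g₁} {α = α} g₀αg₁ g₁βg₂ g₂γg₀
    with u , u∈α* , g₁≈g₀u ← InCoset⇒word g₀αg₁
       | v , v∈β* , g₂≈g₁v ← InCoset⇒word g₁βg₂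
       | w , w∈γ* , g₀≈g₂w ← InCoset⇒word g₂γg₀ =
    g₁ ∙ ⟦ v′ ⟧ ,
    (⟦ w′ ⟧ ⁻¹ , InSub-⁻¹ (w′ , restrict-∈ w∈γ* , refl) , relator-shift g₁≈g₀u projected) ,
    (⟦ v′ ⟧ , (v′ , restrict-∈ v∈β* , refl) , refl)
    where
    v′ = restrict α v
    w′ = restrict α w
    uvw≈ε : ⟦ u ++ (v ++ w) ⟧ ≈ ε
    uvw≈ε = begin
      ⟦ u ++ (v ++ w) ⟧            ≈⟨ ⟦⟧-++ u (v ++ w) ⟩
      ⟦ u ⟧ ∙ ⟦ v ++ w ⟧           ≈⟨ ∙-congˡ (⟦⟧-++ v w) ⟩
      ⟦ u ⟧ ∙ (⟦ v ⟧ ∙ ⟦ w ⟧)      ≈⟨ triangle-relator g₁≈g₀u g₂≈g₁v g₀≈g₂w ⟩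
      ε                            ∎
    projected : ⟦ u ⟧ ∙ (⟦ v′ ⟧ ∙ ⟦ w′ ⟧) ≈ ε
    projected = restrict-triangle compatible u v w u∈α* uvw≈ε

  no-2-cycle : CompatibleWithProperCayleys → ¬ CosetCycle 2
  no-2-cycle compatible cycle =
    disj fz (coset-triangle-meet compatible (step fz) g₁∈g₁G[α₁] (step (fs fz)))
    where
    open CosetCycle cycle
    g₁∈g₁G[α₁] : InCoset (g (fs fz)) (α (fs fz)) (g (fs fz))
    g₁∈g₁G[α₁] = ε , ([] , [] , refl) , sym (identityʳ _)

  no-3-cycle : CompatibleWithProperCayleys → ¬ CosetCycle 3
  no-3-cycle compatible cycle =
    disj fz (coset-triangle-meet compatible (step fz) (step (fs fz)) (step (fs (fs fz))))
    where open CosetCycle cycle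

lemma3p5 : {c ℓ : Level} (k : ℕ) (𝔾 : Group c ℓ) (E𝔾 : EGroup k 𝔾) →
    (∀ (α : Subset k) → α ⊂ ⊤ → EGroup.CompatibleCayley E𝔾 α) →
    EGroup.Acyclic E𝔾 3
lemma3p5 k 𝔾 E𝔾 compatible 1 (s≤s ()) _
lemma3p5 k 𝔾 E𝔾 compatible 2 _ _ = no-2-cycle E𝔾 compatible
lemma3p5 k 𝔾 E𝔾 compatible 3 _ _ = no-3-cycle E𝔾 compatible
lemma3p5 k 𝔾 E𝔾 compatible (suc (suc (suc (suc n)))) _ (s≤s (s≤s (s≤s ())))
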